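{- $\operatorname{Perm}$ is not a group; more precisely, there are $f, g \in \operatorname{Perm}$ such that $fg \notin \operatorname{Perm}$.
   Context: $\mathcal{G}$ is the group of recursive permutations of $\mathbb{N}$ under composition; $\operatorname{Perm}$ is the set of $f\in\mathcal{G}$ whose cycle relation ($x\equiv_f x'$ iff $x' = f^k(x)$ for some $k\in\mathbb{Z}$) is decidable. -}

module Defs where

open import Data.Nat using (ℕ; zero; suc)
open import Data.Fin using (Fin)
open import Data.Vec using (Vec; []; _∷_; lookup)
open import Data.Integer using (ℤ; +_; -[1+_])
open import Data.Product using (Σ; ∃; _×_)
open import Function.Bundles using (_↔_; Inverse)
open import Relation.Binary.PropositionalEquality using (_≡_)
open import Relation.Nullary using (¬_)

data Code : ℕ → Set where
  zer  : ∀ {n} → Code n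
  succ : Code 1
  proj : ∀ {n} → Fin n → Code n
  comp : ∀ {m n} → Code m → Vec (Code n) m → Code n
  prec : ∀ {n} → Code n → Code (suc (suc n)) → Code (suc n)
  mu   : ∀ {n} → Code (suc n) → Code n

mutual
  data Eval : ∀ {n} → Code n → Vec ℕ n → ℕ → Set where
    e-zer  : ∀ {n} {xs : Vec ℕ n} → Eval zer xs 0
    e-succ : ∀ {x} → Eval succ (x ∷ []) (suc x)
    e-proj : ∀ {n} {i : Fin n} {xs} → Eval (proj i) xs (lookup xs i)
    e-comp : ∀ {m n} {f : Code m} {gs : Vec (Code n) m} {xs ys r} →
             EvalAll gs xs ys → Eval f ys r → Eval (comp f gs) xs r
    e-prec-z : ∀ {n} {g : Code n} {h} {xs r} →
             Eval g xs r → Eval (prec g h) (0 ∷ xs) r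
    e-prec-s : ∀ {n} {g : Code n} {h} {k xs r r'} →
             Eval (prec g h) (k ∷ xs) r → Eval h (k ∷ r ∷ xs) r' →
             Eval (prec g h) (suc k ∷ xs) r'
    e-mu   : ∀ {n} {c : Code (suc n)} {xs r} →
             Search c xs 0 r → Eval (mu c) xs r

  data EvalAll {n} : ∀ {m} → Vec (Code n) m → Vec ℕ n → Vec ℕ m → Set where
    []  : ∀ {xs} → EvalAll [] xs []
    _∷_ : ∀ {m} {g : Code n} {gs : Vec (Code n) m} {xs y ys} →
          Eval g xs y → EvalAll gs xs ys → EvalAll (g ∷ gs) xs (y ∷ ys)

  -- Search c xs y r : r is the least z ≥ y with c(z ∷ xs) = 0, and
  -- c(z ∷ xs) is defined for all y ≤ z ≤ r
  data Search {n} (c : Code (suc n)) (xs : Vec ℕ n) : ℕ → ℕ → Set where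
    found : ∀ {y} → Eval c (y ∷ xs) 0 → Search c xs y y
    step  : ∀ {y k r} → Eval c (y ∷ xs) (suc k) → Search c xs (suc y) r →
            Search c xs y r

Recursive : (ℕ → ℕ) → Set
Recursive f = Σ (Code 1) λ c → ∀ x → Eval c (x ∷ []) (f x)

DecidableRel : (ℕ → ℕ → Set) → Set
DecidableRel R = Σ (Code 2) λ c → ∀ x y →
  (R x y → Eval c (x ∷ y ∷ []) 1) × (¬ R x y → Eval c (x ∷ y ∷ []) 0)

iter : (ℕ → ℕ) → ℕ → ℕ → ℕ
iter f zero    x = x
iter f (suc k) x = f (iter f k x)

_^ᶻ_ : ℕ ↔ ℕ → ℤ → ℕ → ℕ
f ^ᶻ (+ k)     = iter (Inverse.to f) k
f ^ᶻ -[1+ k ]  = iter (Inverse.from f) (suc k)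

CycleRel : ℕ ↔ ℕ → ℕ → ℕ → Set
CycleRel f x x' = ∃ λ (k : ℤ) → x' ≡ (f ^ᶻ k) x

InG : ℕ ↔ ℕ → Set
InG f = Recursive (Inverse.to f)

InPerm : ℕ ↔ ℕ → Set
InPerm f = InG f × DecidableRel (CycleRel f)

-- Both permutations are computable involutions, and an involution φ has decidable
-- cycles: y lies in the cycle of x iff y = x or y = φ x. Points of ℕ are coded as triples
-- (e, s, i). The second involution swaps the index i between 2k and 2k + 1; the first
-- swaps s between 2k and 2k + 1 when i = 0, and swaps the indices 2k + 1 and 2k + 2 unless
-- program e, run on its own code, has stopped with output 0 within k steps. So if it does
-- stop, the orbit of (e, 0, 0) under the composite climbs along i, turns back at the
-- stopping time and reaches (e, 1, 0); if it never stops, each involution changes the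
-- parity of s + i, so the composite preserves it and (e, 0, 0), (e, 1, 0) lie in different
-- cycles. A decision procedure for the cycle relation would therefore decide whether a
-- program stops on its own code with output 0, which the diagonal program refutes.
-- Running programs inside the formalism needs a universal function: codes are executed
-- by a small-step machine whose transition function on Cantor-coded states is itself
-- primitive recursive.

module Submission where

open import Defs
open import Data.Bool using (Bool; true; false; not; _xor_; if_then_else_)
open import Data.Bool.Properties using (not-involutive; not-distribˡ-xor; not-distribʳ-xor)
open import Data.Fin using (Fin; zero; suc; toℕ; #_)
open import Data.Integer using (+_; -[1+_])
open import Data.List using (List; []; _∷_; _++_)
open import Data.List.Properties using (++-identityʳ)
open import Data.Nat using (ℕ; zero; suc; _+_; _∸_; pred; _≤_; _<_; z≤n; s≤s; _≟_; _≤?_)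
open import Data.Nat.Induction using (<-rec)
open import Data.Nat.Properties
open import Data.Product using (Σ; ∃; ∃₂; _×_; _,_; proj₁; proj₂)
open import Data.Sum using (_⊎_; inj₁; inj₂)
open import Data.Vec using (Vec; []; _∷_; lookup; toList)
open import Function.Bundles using (_↔_; mk↔ₛ′)
open import Function.Construct.Composition using (_↔-∘_)
open import Relation.Binary.Definitions using (tri<; tri≈; tri>)
open import Relation.Binary.PropositionalEquality
  using (_≡_; _≢_; _≗_; refl; sym; trans; cong; cong₂; subst; module ≡-Reasoning)
open import Relation.Nullary using (¬_; Dec; yes; no; contradiction)

record Computable (n : ℕ) : Set where
  constructor computable
  field
    code    : Code n
    fun     : Vec ℕ n → ℕ
    correct : ∀ xs → Eval code xs (fun xs)
open Computable

withFun : ∀ {n} (F : Computable n) (g : Vec ℕ n → ℕ) → fun F ≗ g → Computable n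
withFun F g F≗g = computable (code F) g λ xs → subst (Eval (code F) xs) (F≗g xs) (correct F xs)

data Term (n : ℕ) : Set where
  var : Fin n → Term n
  app : ∀ {k} → Computable k → Vec (Term n) k → Term n

mutual
  ⟦_⟧ : ∀ {n} → Term n → Vec ℕ n → ℕ
  ⟦ var i ⟧    xs = lookup xs i
  ⟦ app F ts ⟧ xs = fun F (⟦ ts ⟧* xs)

  ⟦_⟧* : ∀ {n k} → Vec (Term n) k → Vec ℕ n → Vec ℕ k
  ⟦ [] ⟧*     xs = []
  ⟦ t ∷ ts ⟧* xs = ⟦ t ⟧ xs ∷ ⟦ ts ⟧* xs

mutual
  codeOf : ∀ {n} → Term n → Code n
  codeOf (var i)    = proj i
  codeOf (app F ts) = comp (code F) (codeOf* ts)

  codeOf* : ∀ {n k} → Vec (Term n) k → Vec (Code n) k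
  codeOf* []       = []
  codeOf* (t ∷ ts) = codeOf t ∷ codeOf* ts

mutual
  codeOf-correct : ∀ {n} (t : Term n) xs → Eval (codeOf t) xs (⟦ t ⟧ xs)
  codeOf-correct (var i)    xs = e-proj
  codeOf-correct (app F ts) xs = e-comp (codeOf*-correct ts xs) (correct F _)

  codeOf*-correct : ∀ {n k} (ts : Vec (Term n) k) xs → EvalAll (codeOf* ts) xs (⟦ ts ⟧* xs)
  codeOf*-correct []       xs = []
  codeOf*-correct (t ∷ ts) xs = codeOf-correct t xs ∷ codeOf*-correct ts xs

compile : ∀ {n} → Term n → Computable n
compile t = computable (codeOf t) ⟦ t ⟧ (codeOf-correct t)

zeroᶜ : ∀ {n} → Computable n
zeroᶜ = computable zer (λ _ → 0) (λ _ → e-zer)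

sucᶜ : Computable 1
sucᶜ = computable succ (λ { (x ∷ []) → suc x }) (λ { (x ∷ []) → e-succ })

primRec : ∀ {n} → (Vec ℕ n → ℕ) → (Vec ℕ (suc (suc n)) → ℕ) → Vec ℕ (suc n) → ℕ
primRec g h (zero  ∷ xs) = g xs
primRec g h (suc k ∷ xs) = h (k ∷ primRec g h (k ∷ xs) ∷ xs)

primRecᶜ : ∀ {n} → Computable n → Computable (suc (suc n)) → Computable (suc n)
primRecᶜ G H = computable (prec (code G) (code H)) (primRec (fun G) (fun H)) eval
  where
  eval : ∀ xs → Eval (prec (code G) (code H)) xs (primRec (fun G) (fun H) xs)
  eval (zero  ∷ xs) = e-prec-z (correct G xs)
  eval (suc k ∷ xs) = e-prec-s (eval (k ∷ xs)) (correct H _)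

byPrimRec : ∀ {n} (f : Vec ℕ (suc n) → ℕ) (G : Computable n) (H : Computable (suc (suc n))) →
            (∀ xs → fun G xs ≡ f (0 ∷ xs)) →
            (∀ k xs → fun H (k ∷ f (k ∷ xs) ∷ xs) ≡ f (suc k ∷ xs)) →
            Computable (suc n)
byPrimRec f G H base next = withFun (primRecᶜ G H) f agrees
  where
  agrees : ∀ xs → primRec (fun G) (fun H) xs ≡ f xs
  agrees (zero  ∷ xs) = base xs
  agrees (suc k ∷ xs) = trans (cong (λ r → fun H (k ∷ r ∷ xs)) (agrees (k ∷ xs))) (next k xs)

x₀ : ∀ {n} → Term (suc n)
x₀ = var (# 0)

x₁ : ∀ {n} → Term (suc (suc n))
x₁ = var (# 1)

x₃ : ∀ {n} → Term (suc (suc (suc (suc n))))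
x₃ = var (# 3)

app₁ : ∀ {n} → Computable 1 → Term n → Term n
app₁ F a = app F (a ∷ [])

app₂ : ∀ {n} → Computable 2 → Term n → Term n → Term n
app₂ F a b = app F (a ∷ b ∷ [])

app₃ : ∀ {n} → Computable 3 → Term n → Term n → Term n → Term n
app₃ F a b c = app F (a ∷ b ∷ c ∷ [])

lit : ∀ {n} → ℕ → Term n
lit zero    = app zeroᶜ []
lit (suc k) = app₁ sucᶜ (lit k)

addᶜ : Computable 2
addᶜ = byPrimRec (λ { (a ∷ b ∷ []) → a + b }) (compile x₀) (compile (app₁ sucᶜ x₁))
         (λ { (b ∷ []) → refl }) (λ { k (b ∷ []) → refl })

predᶜ : Computable 1
predᶜ = byPrimRec (λ { (a ∷ []) → pred a }) zeroᶜ (compile x₀)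
          (λ { [] → refl }) (λ { k [] → refl })

monusᶜ : Computable 2
monusᶜ = withFun (compile (app₂ flippedMonusᶜ x₁ x₀)) (λ { (a ∷ b ∷ []) → a ∸ b })
           (λ { (a ∷ b ∷ []) → refl })
  where
  flippedMonusᶜ : Computable 2
  flippedMonusᶜ = byPrimRec (λ { (a ∷ b ∷ []) → b ∸ a }) (compile x₀) (compile (app₁ predᶜ x₁))
                    (λ { (b ∷ []) → refl }) (λ { k (b ∷ []) → pred[m∸n]≡m∸[1+n] b k })

ifZero : ℕ → ℕ → ℕ → ℕ
ifZero zero    a b = a
ifZero (suc _) a b = b

ifZeroᶜ : Computable 3
ifZeroᶜ = byPrimRec (λ { (t ∷ a ∷ b ∷ []) → ifZero t a b }) (compile x₀) (compile x₃)
            (λ { (a ∷ b ∷ []) → refl }) (λ { k (a ∷ b ∷ []) → refl })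

tri : ℕ → ℕ
tri zero    = 0
tri (suc n) = suc n + tri n

triᶜ : Computable 1
triᶜ = byPrimRec (λ { (n ∷ []) → tri n }) zeroᶜ (compile (app₂ addᶜ (app₁ sucᶜ x₀) x₁))
         (λ { [] → refl }) (λ { k [] → refl })

-- Cantor pairing

tri-mono-≤ : ∀ {a b} → a ≤ b → tri a ≤ tri b
tri-mono-≤ {zero}  {b}     _         = z≤n
tri-mono-≤ {suc a} {suc b} (s≤s a≤b) = +-mono-≤ (s≤s a≤b) (tri-mono-≤ a≤b)

tri-bracket-unique : ∀ {w v p} → tri w ≤ p → p < tri (suc w) → tri v ≤ p → p < tri (suc v) → w ≡ v
tri-bracket-unique {w} {v} lo₁ hi₁ lo₂ hi₂ with <-cmp w v
... | tri≈ _ w≡v _ = w≡v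
... | tri< w<v _ _ = contradiction (≤-trans (tri-mono-≤ w<v) lo₂) (<⇒≱ hi₁)
... | tri> _ _ v<w = contradiction (≤-trans (tri-mono-≤ v<w) lo₁) (<⇒≱ hi₂)

opaque
  pair : ℕ → ℕ → ℕ
  pair a b = tri (a + b) + b

  leq : ℕ → ℕ → ℕ
  leq x y = 1 ∸ (x ∸ y)

  -- the unique w with tri w ≤ p < tri (suc w)
  diagonal : ℕ → ℕ
  diagonal zero    = 0
  diagonal (suc p) = diagonal p + leq (tri (suc (diagonal p))) (suc p)

  snd : ℕ → ℕ
  snd p = p ∸ tri (diagonal p)

  fst : ℕ → ℕ
  fst p = diagonal p ∸ snd p

  leq-≤ : ∀ {x y} → x ≤ y → leq x y ≡ 1
  leq-≤ x≤y rewrite m≤n⇒m∸n≡0 x≤y = refl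

  leq-≰ : ∀ {x y} → ¬ x ≤ y → leq x y ≡ 0
  leq-≰ {x} {y} x≰y with x ∸ y in eq
  ... | zero  = contradiction (m∸n≡0⇒m≤n eq) x≰y
  ... | suc k = 0∸n≡0 k

  diagonal-bracket : ∀ p → tri (diagonal p) ≤ p × p < tri (suc (diagonal p))
  diagonal-bracket zero = z≤n , s≤s z≤n
  diagonal-bracket (suc p) with diagonal-bracket p | tri (suc (diagonal p)) ≤? suc p
  ... | lo , hi | yes reached rewrite leq-≤ reached | +-comm (diagonal p) 1 =
    reached , subst (λ q → q < tri (suc (suc (diagonal p)))) (≤-antisym reached hi) below-next
    where
    below-next : tri (suc (diagonal p)) < tri (suc (suc (diagonal p)))
    below-next = m<n+m (tri (suc (diagonal p))) {suc (suc (diagonal p))} (s≤s z≤n)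
  ... | lo , hi | no unreached rewrite leq-≰ unreached | +-identityʳ (diagonal p) =
    m≤n⇒m≤1+n lo , ≰⇒> unreached

  pair-bracket : ∀ a b → tri (a + b) ≤ pair a b × pair a b < tri (suc (a + b))
  pair-bracket a b = m≤m+n (tri (a + b)) b , (begin-strict
    tri (a + b) + b       <⟨ +-monoʳ-< (tri (a + b)) (s≤s (m≤n+m b a)) ⟩
    tri (a + b) + suc (a + b) ≡⟨ +-comm (tri (a + b)) (suc (a + b)) ⟩
    tri (suc (a + b))     ∎)
    where open ≤-Reasoning

  diagonal-pair : ∀ a b → diagonal (pair a b) ≡ a + b
  diagonal-pair a b = tri-bracket-unique (proj₁ (diagonal-bracket (pair a b))) (proj₂ (diagonal-bracket (pair a b)))
                                         (proj₁ (pair-bracket a b)) (proj₂ (pair-bracket a b))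

  snd-pair : ∀ a b → snd (pair a b) ≡ b
  snd-pair a b rewrite diagonal-pair a b = m+n∸m≡n (tri (a + b)) b

  fst-pair : ∀ a b → fst (pair a b) ≡ a
  fst-pair a b rewrite snd-pair a b | diagonal-pair a b = m+n∸n≡m a b

  pair-fst-snd : ∀ p → pair (fst p) (snd p) ≡ p
  pair-fst-snd p = trans (cong (λ w → tri w + snd p) (m∸n+n≡m snd≤diagonal)) (m+[n∸m]≡n lo)
    where
    lo : tri (diagonal p) ≤ p
    lo = proj₁ (diagonal-bracket p)
    snd≤diagonal : snd p ≤ diagonal p
    snd≤diagonal = ≤-pred (+-cancelˡ-< (tri (diagonal p)) (snd p) (suc (diagonal p)) (begin-strict
      tri (diagonal p) + (p ∸ tri (diagonal p)) ≡⟨ m+[n∸m]≡n lo ⟩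
      p                                        <⟨ proj₂ (diagonal-bracket p) ⟩
      suc (diagonal p) + tri (diagonal p)      ≡⟨ +-comm (suc (diagonal p)) (tri (diagonal p)) ⟩
      tri (diagonal p) + suc (diagonal p)      ∎))
      where open ≤-Reasoning

  fst-zero : fst 0 ≡ 0
  fst-zero = refl

  snd-zero : snd 0 ≡ 0
  snd-zero = refl

  leqᶜ : Computable 2
  leqᶜ = withFun (compile (app₂ monusᶜ (lit 1) (app₂ monusᶜ x₀ x₁))) (λ { (x ∷ y ∷ []) → leq x y })
           (λ { (x ∷ y ∷ []) → refl })

  diagonalᶜ : Computable 1
  diagonalᶜ = byPrimRec (λ { (p ∷ []) → diagonal p }) zeroᶜ
                (compile (app₂ addᶜ x₁ (app₂ leqᶜ (app₁ triᶜ (app₁ sucᶜ x₁)) (app₁ sucᶜ x₀))))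
                (λ { [] → refl }) (λ { k [] → refl })

  pairTerm : Term 2
  pairTerm = app₂ addᶜ (app₁ triᶜ (app₂ addᶜ x₀ x₁)) x₁

  sndTerm : Term 1
  sndTerm = app₂ monusᶜ x₀ (app₁ triᶜ (app₁ diagonalᶜ x₀))

  fstTerm : Term 1
  fstTerm = app₂ monusᶜ (app₁ diagonalᶜ x₀) sndTerm

  pairTerm-correct : ∀ a b → ⟦ pairTerm ⟧ (a ∷ b ∷ []) ≡ pair a b
  pairTerm-correct a b = refl

  sndTerm-correct : ∀ p → ⟦ sndTerm ⟧ (p ∷ []) ≡ snd p
  sndTerm-correct p = refl

  fstTerm-correct : ∀ p → ⟦ fstTerm ⟧ (p ∷ []) ≡ fst p
  fstTerm-correct p = refl

pairᶜ : Computable 2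
pairᶜ = withFun (compile pairTerm) (λ { (a ∷ b ∷ []) → pair a b })
          (λ { (a ∷ b ∷ []) → pairTerm-correct a b })

sndᶜ : Computable 1
sndᶜ = withFun (compile sndTerm) (λ { (p ∷ []) → snd p }) (λ { (p ∷ []) → sndTerm-correct p })

fstᶜ : Computable 1
fstᶜ = withFun (compile fstTerm) (λ { (p ∷ []) → fst p }) (λ { (p ∷ []) → fstTerm-correct p })

pair-injective : ∀ {a b a′ b′} → pair a b ≡ pair a′ b′ → a ≡ a′ × b ≡ b′
pair-injective {a} {b} {a′} {b′} eq =
  trans (sym (fst-pair a b)) (trans (cong fst eq) (fst-pair a′ b′)) ,
  trans (sym (snd-pair a b)) (trans (cong snd eq) (snd-pair a′ b′))

unpair₂ : ∀ (G : ℕ → ℕ → ℕ) a b → G (fst (pair a b)) (snd (pair a b)) ≡ G a b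
unpair₂ G a b rewrite fst-pair a b | snd-pair a b = refl

unpair₃ : ∀ (G : ℕ → ℕ → ℕ → ℕ) a b c →
          G (fst (pair a (pair b c))) (fst (snd (pair a (pair b c)))) (snd (snd (pair a (pair b c)))) ≡ G a b c
unpair₃ G a b c = trans (unpair₂ (λ x q → G x (fst q) (snd q)) a (pair b c)) (unpair₂ (G a) b c)

unpair₄ : ∀ (G : ℕ → ℕ → ℕ → ℕ → ℕ) a b c d → let p = pair a (pair b (pair c d)) in
          G (fst p) (fst (snd p)) (fst (snd (snd p))) (snd (snd (snd p))) ≡ G a b c d
unpair₄ G a b c d =
  trans (unpair₂ (λ x q → G x (fst q) (fst (snd q)) (snd (snd q))) a (pair b (pair c d))) (unpair₃ (G a) b c d)

unpair₅ : ∀ (G : ℕ → ℕ → ℕ → ℕ → ℕ → ℕ) a b c d e →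
          let p = pair a (pair b (pair c (pair d e))) in
          G (fst p) (fst (snd p)) (fst (snd (snd p))) (fst (snd (snd (snd p)))) (snd (snd (snd (snd p)))) ≡ G a b c d e
unpair₅ G a b c d e =
  trans (unpair₂ (λ x q → G x (fst q) (fst (snd q)) (fst (snd (snd q))) (snd (snd (snd q))))
                 a (pair b (pair c (pair d e))))
        (unpair₄ (G a) b c d e)

-- A small-step machine for codes

data UCode : Set where
  uzer usucc : UCode
  uproj      : ℕ → UCode
  ucomp      : UCode → List UCode → UCode
  uprec      : UCode → UCode → UCode
  umu        : UCode → UCode

-- The argument codes of a composition are stored in reverse order: the machine
-- pushes each computed argument onto an accumulator, which thus ends up in order.
mutual
  erase : ∀ {n} → Code n → UCode
  erase zer         = uzer
  erase succ        = usucc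
  erase (proj i)    = uproj (toℕ i)
  erase (comp f gs) = ucomp (erase f) (eraseArgs gs [])
  erase (prec g h)  = uprec (erase g) (erase h)
  erase (mu c)      = umu (erase c)

  eraseArgs : ∀ {n m} → Vec (Code n) m → List UCode → List UCode
  eraseArgs []       acc = acc
  eraseArgs (g ∷ gs) acc = eraseArgs gs (erase g ∷ acc)

data Frame : Set where
  argsFrame : List UCode → List ℕ → List ℕ → UCode → Frame
  recFrame  : UCode → ℕ → List ℕ → Frame
  muFrame   : UCode → List ℕ → ℕ → Frame

data State : Set where
  call    : UCode → List ℕ → List Frame → State
  collect : List UCode → List ℕ → List ℕ → UCode → List Frame → State
  ret     : ℕ → List Frame → State

hd : List ℕ → ℕ
hd []      = 0
hd (x ∷ _) = x

tl : List ℕ → List ℕ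
tl []      = []
tl (_ ∷ l) = l

tl^ : ℕ → List ℕ → List ℕ
tl^ zero    l = l
tl^ (suc i) l = tl (tl^ i l)

recStep : UCode → UCode → List ℕ → List Frame → ℕ → State
recStep g h xs K zero    = call g (tl xs) K
recStep g h xs K (suc k) = call (uprec g h) (k ∷ tl xs) (recFrame h k (tl xs) ∷ K)

muStep : UCode → List ℕ → ℕ → List Frame → ℕ → State
muStep c xs y K zero    = ret y K
muStep c xs y K (suc _) = call c (suc y ∷ xs) (muFrame c xs (suc y) ∷ K)

δ : State → State
δ (call uzer        xs K)                 = ret 0 K
δ (call usucc       xs K)                 = ret (suc (hd xs)) K
δ (call (uproj i)   xs K)                 = ret (hd (tl^ i xs)) K
δ (call (ucomp f L) xs K)                 = collect L xs [] f K
δ (call (uprec g h) xs K)                 = recStep g h xs K (hd xs)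
δ (call (umu c)     xs K)                 = call c (0 ∷ xs) (muFrame c xs 0 ∷ K)
δ (collect []      xs ys f K)             = call f ys K
δ (collect (g ∷ L) xs ys f K)             = call g xs (argsFrame L xs ys f ∷ K)
δ (ret v [])                              = ret v []
δ (ret v (argsFrame L xs ys f ∷ K))       = collect L xs (v ∷ ys) f K
δ (ret v (recFrame h k xs ∷ K))           = call h (k ∷ v ∷ xs) K
δ (ret v (muFrame c xs y ∷ K))            = muStep c xs y K v

infixr 5 _◅◅_
data _↠_ : State → State → Set where
  done  : ∀ {s} → s ↠ s
  later : ∀ {s t} → δ s ↠ t → s ↠ t

_◅◅_ : ∀ {s t u} → s ↠ t → t ↠ u → s ↠ u
done    ◅◅ q = q
later p ◅◅ q = later (p ◅◅ q)

hd-tl^-lookup : ∀ {n} (xs : Vec ℕ n) (i : Fin n) → hd (tl^ (toℕ i) (toList xs)) ≡ lookup xs i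
hd-tl^-lookup (x ∷ xs) zero    = refl
hd-tl^-lookup (x ∷ xs) (suc i) = trans (cong hd (tl^-suc (toℕ i) x (toList xs))) (hd-tl^-lookup xs i)
  where
  tl^-suc : ∀ j y l → tl^ (suc j) (y ∷ l) ≡ tl^ j l
  tl^-suc zero    y l = refl
  tl^-suc (suc j) y l = cong tl (tl^-suc j y l)

mutual
  eval⇒↠ : ∀ {n} {c : Code n} {xs r} → Eval c xs r → ∀ K → call (erase c) (toList xs) K ↠ ret r K
  eval⇒↠ e-zer K = later done
  eval⇒↠ e-succ K = later done
  eval⇒↠ (e-proj {i = i} {xs = xs}) K =
    later (subst (λ v → ret v K ↠ ret (lookup xs i) K) (sym (hd-tl^-lookup xs i)) done)
  eval⇒↠ (e-comp {f = f} {ys = ys} args ef) K =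
    later (evalAll⇒↠ args [] [] (erase f) K ◅◅
           later (subst (λ l → call (erase f) l K ↠ _) (sym (++-identityʳ (toList ys))) (eval⇒↠ ef K)))
  eval⇒↠ (e-prec-z eg) K = later (eval⇒↠ eg K)
  eval⇒↠ (e-prec-s erec eh) K = later (eval⇒↠ erec _ ◅◅ later (eval⇒↠ eh K))
  eval⇒↠ (e-mu s) K = later (search⇒↠ s K)

  evalAll⇒↠ : ∀ {n m} {gs : Vec (Code n) m} {xs ys} → EvalAll gs xs ys → ∀ L zs f K →
              collect (eraseArgs gs L) (toList xs) zs f K ↠ collect L (toList xs) (toList ys ++ zs) f K
  evalAll⇒↠ []         L zs f K = done
  evalAll⇒↠ (eg ∷ egs) L zs f K = evalAll⇒↠ egs _ zs f K ◅◅ later (eval⇒↠ eg _ ◅◅ later done)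

  search⇒↠ : ∀ {n} {c : Code (suc n)} {xs y r} → Search c xs y r → ∀ K →
             call (erase c) (y ∷ toList xs) (muFrame (erase c) (toList xs) y ∷ K) ↠ ret r K
  search⇒↠ (found e0)    K = eval⇒↠ e0 _ ◅◅ later done
  search⇒↠ (step e1 s)   K = eval⇒↠ e1 _ ◅◅ later (search⇒↠ s K)

-- Arithmetisation of the machine

cons : ℕ → ℕ → ℕ
cons x l = suc (pair x l)

hdℕ tlℕ : ℕ → ℕ
hdℕ l = fst (pred l)
tlℕ l = snd (pred l)

tl^ℕ : ℕ → ℕ → ℕ
tl^ℕ zero    l = l
tl^ℕ (suc i) l = tlℕ (tl^ℕ i l)

encList : List ℕ → ℕ
encList []       = 0
encList (x ∷ xs) = cons x (encList xs)

mutual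
  encCode : UCode → ℕ
  encCode u = pair (codeTag u) (codePayload u)

  codeTag : UCode → ℕ
  codeTag uzer        = 0
  codeTag usucc       = 1
  codeTag (uproj _)   = 2
  codeTag (ucomp _ _) = 3
  codeTag (uprec _ _) = 4
  codeTag (umu _)     = 5

  codePayload : UCode → ℕ
  codePayload uzer        = 0
  codePayload usucc       = 0
  codePayload (uproj i)   = i
  codePayload (ucomp f L) = pair (encCode f) (encCodes L)
  codePayload (uprec g h) = pair (encCode g) (encCode h)
  codePayload (umu c)     = encCode c

  encCodes : List UCode → ℕ
  encCodes []      = 0
  encCodes (u ∷ L) = cons (encCode u) (encCodes L)

frameTag : Frame → ℕ
frameTag (argsFrame _ _ _ _) = 0
frameTag (recFrame _ _ _)    = 1
frameTag (muFrame _ _ _)     = 2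

framePayload : Frame → ℕ
framePayload (argsFrame L xs ys f) = pair (encCodes L) (pair (encList xs) (pair (encList ys) (encCode f)))
framePayload (recFrame h k xs)     = pair (encCode h) (pair k (encList xs))
framePayload (muFrame c xs y)      = pair (encCode c) (pair (encList xs) y)

encStack : List Frame → ℕ
encStack []       = 0
encStack (F ∷ K) = cons (pair (frameTag F) (framePayload F)) (encStack K)

callℕ : ℕ → ℕ → ℕ → ℕ
callℕ c xs K = pair 0 (pair c (pair xs K))

collectℕ : ℕ → ℕ → ℕ → ℕ → ℕ → ℕ
collectℕ L xs ys f K = pair 1 (pair L (pair xs (pair ys (pair f K))))

retℕ : ℕ → ℕ → ℕ
retℕ v K = pair 2 (pair v K)

encState : State → ℕ
encState (call c xs K)         = callℕ (encCode c) (encList xs) (encStack K)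
encState (collect L xs ys f K) = collectℕ (encCodes L) (encList xs) (encList ys) (encCode f) (encStack K)
encState (ret v K)             = retℕ v (encStack K)

hdℕ-encList : ∀ xs → hdℕ (encList xs) ≡ hd xs
hdℕ-encList []       = fst-zero
hdℕ-encList (x ∷ xs) = fst-pair x (encList xs)

tlℕ-encList : ∀ xs → tlℕ (encList xs) ≡ encList (tl xs)
tlℕ-encList []       = snd-zero
tlℕ-encList (x ∷ xs) = snd-pair x (encList xs)

tl^ℕ-encList : ∀ i xs → tl^ℕ i (encList xs) ≡ encList (tl^ i xs)
tl^ℕ-encList zero    xs = refl
tl^ℕ-encList (suc i) xs = trans (cong tlℕ (tl^ℕ-encList i xs)) (tlℕ-encList (tl^ i xs))

app₄ : ∀ {n} → Computable 4 → Term n → Term n → Term n → Term n → Term n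
app₄ F a b c d = app F (a ∷ b ∷ c ∷ d ∷ [])

app₅ : ∀ {n} → Computable 5 → Term n → Term n → Term n → Term n → Term n → Term n
app₅ F a b c d e = app F (a ∷ b ∷ c ∷ d ∷ e ∷ [])

PAIR : ∀ {n} → Term n → Term n → Term n
PAIR = app₂ pairᶜ

FST SND SUC PRED HD TL : ∀ {n} → Term n → Term n
FST    = app₁ fstᶜ
SND    = app₁ sndᶜ
SUC    = app₁ sucᶜ
PRED   = app₁ predᶜ
HD l   = FST (PRED l)
TL l   = SND (PRED l)

IFZ : ∀ {n} → Term n → Term n → Term n → Term n
IFZ = app₃ ifZeroᶜ

CONS : ∀ {n} → Term n → Term n → Term n
CONS x l = SUC (PAIR x l)

CALL : ∀ {n} → Term n → Term n → Term n → Term n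
CALL c xs K = PAIR (lit 0) (PAIR c (PAIR xs K))

COLLECT : ∀ {n} → Term n → Term n → Term n → Term n → Term n → Term n
COLLECT L xs ys f K = PAIR (lit 1) (PAIR L (PAIR xs (PAIR ys (PAIR f K))))

RET : ∀ {n} → Term n → Term n → Term n
RET v K = PAIR (lit 2) (PAIR v K)

CASES : ∀ {n} → Term n → List (Term n) → Term n → Term n
CASES t []       d = d
CASES t (b ∷ bs) d = IFZ t b (CASES (PRED t) bs d)

tl^ᶜ : Computable 2
tl^ᶜ = byPrimRec (λ { (i ∷ l ∷ []) → tl^ℕ i l }) (compile x₀) (compile (TL x₁))
         (λ { (l ∷ []) → refl }) (λ { i (l ∷ []) → refl })

recStepᶜ : Computable 5
recStepᶜ = compile (IFZ n (CALL g xs K)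
                          (CALL (PAIR (lit 4) (PAIR g h)) (CONS (PRED n) xs)
                                (CONS (PAIR (lit 1) (PAIR h (PAIR (PRED n) xs))) K)))
  where
  g h n xs K : Term 5
  g  = var (# 0)
  h  = var (# 1)
  n  = var (# 2)
  xs = var (# 3)
  K  = var (# 4)

muStepᶜ : Computable 5
muStepᶜ = compile (IFZ v (RET y K)
                         (CALL c (CONS (SUC y) xs) (CONS (PAIR (lit 2) (PAIR c (PAIR xs (SUC y)))) K)))
  where
  c xs y K v : Term 5
  c  = var (# 0)
  xs = var (# 1)
  y  = var (# 2)
  K  = var (# 3)
  v  = var (# 4)

callStepᶜ : Computable 4
callStepᶜ = compile (CASES t
  ( RET (lit 0) K
  ∷ RET (SUC (HD xs)) K
  ∷ RET (HD (app₂ tl^ᶜ p xs)) K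
  ∷ COLLECT (SND p) xs (lit 0) (FST p) K
  ∷ app₅ recStepᶜ (FST p) (SND p) (HD xs) (TL xs) K
  ∷ [])
  (CALL p (CONS (lit 0) xs) (CONS (PAIR (lit 2) (PAIR p (PAIR xs (lit 0)))) K)))
  where
  t p xs K : Term 4
  t  = var (# 0)
  p  = var (# 1)
  xs = var (# 2)
  K  = var (# 3)

collectStepᶜ : Computable 5
collectStepᶜ = compile (IFZ L (CALL f ys K)
                              (CALL (HD L) xs (CONS (PAIR (lit 0) (PAIR (TL L) (PAIR xs (PAIR ys f)))) K)))
  where
  L xs ys f K : Term 5
  L  = var (# 0)
  xs = var (# 1)
  ys = var (# 2)
  f  = var (# 3)
  K  = var (# 4)

frameReturnᶜ : Computable 4
frameReturnᶜ = compile (CASES t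
  ( COLLECT (FST p) (FST (SND p)) (CONS v (FST (SND (SND p)))) (SND (SND (SND p))) K
  ∷ CALL (FST p) (CONS (FST (SND p)) (CONS v (SND (SND p)))) K
  ∷ [])
  (app₅ muStepᶜ (FST p) (FST (SND p)) (SND (SND p)) K v))
  where
  v t p K : Term 4
  v = var (# 0)
  t = var (# 1)
  p = var (# 2)
  K = var (# 3)

retStepᶜ : Computable 2
retStepᶜ = compile (IFZ K (RET v (lit 0)) (app₄ frameReturnᶜ v (FST (HD K)) (SND (HD K)) (TL K)))
  where
  v K : Term 2
  v = var (# 0)
  K = var (# 1)

dispatchᶜ : Computable 2
dispatchᶜ = compile (CASES t
  ( app₄ callStepᶜ (FST (FST q)) (SND (FST q)) (FST (SND q)) (SND (SND q))
  ∷ app₅ collectStepᶜ (FST q) (FST (SND q)) (FST (SND (SND q))) (FST (SND (SND (SND q)))) (SND (SND (SND (SND q))))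
  ∷ [])
  (app₂ retStepᶜ (FST q) (SND q)))
  where
  t q : Term 2
  t = var (# 0)
  q = var (# 1)

δᶜ : Computable 1
δᶜ = compile (app₂ dispatchᶜ (FST x₀) (SND x₀))

recStepℕ muStepℕ collectStepℕ : ℕ → ℕ → ℕ → ℕ → ℕ → ℕ
recStepℕ     a b c d e = fun recStepᶜ     (a ∷ b ∷ c ∷ d ∷ e ∷ [])
muStepℕ      a b c d e = fun muStepᶜ      (a ∷ b ∷ c ∷ d ∷ e ∷ [])
collectStepℕ a b c d e = fun collectStepᶜ (a ∷ b ∷ c ∷ d ∷ e ∷ [])

callStepℕ frameReturnℕ : ℕ → ℕ → ℕ → ℕ → ℕ
callStepℕ    a b c d = fun callStepᶜ    (a ∷ b ∷ c ∷ d ∷ [])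
frameReturnℕ a b c d = fun frameReturnᶜ (a ∷ b ∷ c ∷ d ∷ [])

retStepℕ dispatchℕ : ℕ → ℕ → ℕ
retStepℕ  a b = fun retStepᶜ  (a ∷ b ∷ [])
dispatchℕ a b = fun dispatchᶜ (a ∷ b ∷ [])

δℕ : ℕ → ℕ
δℕ s = fun δᶜ (s ∷ [])

recStep-encodes : ∀ g h xs K n →
  recStepℕ (encCode g) (encCode h) n (encList (tl xs)) (encStack K) ≡ encState (recStep g h xs K n)
recStep-encodes g h xs K zero    = refl
recStep-encodes g h xs K (suc n) = refl

muStep-encodes : ∀ c xs y K v → muStepℕ (encCode c) (encList xs) y (encStack K) v ≡ encState (muStep c xs y K v)
muStep-encodes c xs y K zero    = refl
muStep-encodes c xs y K (suc v) = refl

callStep-encodes : ∀ u xs K →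
  callStepℕ (codeTag u) (codePayload u) (encList xs) (encStack K) ≡ encState (δ (call u xs K))
callStep-encodes uzer        xs K = refl
callStep-encodes usucc       xs K = cong (λ z → retℕ (suc z) (encStack K)) (hdℕ-encList xs)
callStep-encodes (uproj i)   xs K =
  cong (λ z → retℕ z (encStack K)) (trans (cong hdℕ (tl^ℕ-encList i xs)) (hdℕ-encList (tl^ i xs)))
callStep-encodes (ucomp f L) xs K =
  unpair₂ (λ a b → collectℕ b (encList xs) 0 a (encStack K)) (encCode f) (encCodes L)
callStep-encodes (uprec g h) xs K = begin
    recStepℕ (fst (pair G H)) (snd (pair G H)) (hdℕ X) (tlℕ X) K′
  ≡⟨ unpair₂ (λ a b → recStepℕ a b (hdℕ X) (tlℕ X) K′) G H ⟩
    recStepℕ G H (hdℕ X) (tlℕ X) K′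
  ≡⟨ cong₂ (λ n t → recStepℕ G H n t K′) (hdℕ-encList xs) (tlℕ-encList xs) ⟩
    recStepℕ G H (hd xs) (encList (tl xs)) K′
  ≡⟨ recStep-encodes g h xs K (hd xs) ⟩
    encState (recStep g h xs K (hd xs))
  ∎
  where
  open ≡-Reasoning
  G H X K′ : ℕ
  G  = encCode g
  H  = encCode h
  X  = encList xs
  K′ = encStack K
callStep-encodes (umu c)     xs K = refl

collectStep-encodes : ∀ L xs ys f K →
  collectStepℕ (encCodes L) (encList xs) (encList ys) (encCode f) (encStack K) ≡ encState (δ (collect L xs ys f K))
collectStep-encodes []      xs ys f K = refl
collectStep-encodes (g ∷ L) xs ys f K =
  unpair₂ (λ a b → callℕ a (encList xs) (cons (pair 0 (pair b (pair (encList xs) (pair (encList ys) (encCode f)))))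
                                               (encStack K)))
          (encCode g) (encCodes L)

frameReturn-encodes : ∀ v F K →
  frameReturnℕ v (frameTag F) (framePayload F) (encStack K) ≡ encState (δ (ret v (F ∷ K)))
frameReturn-encodes v (argsFrame L xs ys f) K =
  unpair₄ (λ a b c d → collectℕ a b (cons v c) d (encStack K)) (encCodes L) (encList xs) (encList ys) (encCode f)
frameReturn-encodes v (recFrame h k xs) K =
  unpair₃ (λ a b c → callℕ a (cons b (cons v c)) (encStack K)) (encCode h) k (encList xs)
frameReturn-encodes v (muFrame c xs y) K =
  trans (unpair₃ (λ a b d → muStepℕ a b d (encStack K) v) (encCode c) (encList xs) y) (muStep-encodes c xs y K v)

retStep-encodes : ∀ v K → retStepℕ v (encStack K) ≡ encState (δ (ret v K))
retStep-encodes v []      = refl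
retStep-encodes v (F ∷ K) =
  trans (unpair₂ (λ a b → frameReturnℕ v (fst a) (snd a) b) (pair (frameTag F) (framePayload F)) (encStack K))
  (trans (unpair₂ (λ t p → frameReturnℕ v t p (encStack K)) (frameTag F) (framePayload F))
         (frameReturn-encodes v F K))

δℕ-encState : ∀ s → δℕ (encState s) ≡ encState (δ s)
δℕ-encState (call u xs K) =
  trans (unpair₂ dispatchℕ 0 _)
  (trans (unpair₃ (λ c x k → callStepℕ (fst c) (snd c) x k) (encCode u) (encList xs) (encStack K))
  (trans (unpair₂ (λ t p → callStepℕ t p (encList xs) (encStack K)) (codeTag u) (codePayload u))
         (callStep-encodes u xs K)))
δℕ-encState (collect L xs ys f K) =
  trans (unpair₂ dispatchℕ 1 _)
  (trans (unpair₅ collectStepℕ (encCodes L) (encList xs) (encList ys) (encCode f) (encStack K))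
         (collectStep-encodes L xs ys f K))
δℕ-encState (ret v K) =
  trans (unpair₂ dispatchℕ 2 _) (trans (unpair₂ retStepℕ v (encStack K)) (retStep-encodes v K))

iter-+ : ∀ (f : ℕ → ℕ) m n x → iter f (m + n) x ≡ iter f m (iter f n x)
iter-+ f zero    n x = refl
iter-+ f (suc m) n x = cong f (iter-+ f m n x)

iter-inner : ∀ (f : ℕ → ℕ) m x → iter f m (f x) ≡ f (iter f m x)
iter-inner f zero    x = refl
iter-inner f (suc m) x = cong f (iter-inner f m x)

↠⇒iterδℕ : ∀ {s t} → s ↠ t → ∃ λ m → iter δℕ m (encState s) ≡ encState t
↠⇒iterδℕ done = 0 , refl
↠⇒iterδℕ {s} {t} (later p) with ↠⇒iterδℕ p
... | m , reaches = suc m , (begin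
  iter δℕ (suc m) (encState s) ≡⟨ sym (iter-inner δℕ m (encState s)) ⟩
  iter δℕ m (δℕ (encState s))  ≡⟨ cong (iter δℕ m) (δℕ-encState s) ⟩
  iter δℕ m (encState (δ s))   ≡⟨ reaches ⟩
  encState t                   ∎)
  where open ≡-Reasoning

initialℕ : ℕ → ℕ
initialℕ e = callℕ e (cons e 0) 0

runℕ : ℕ → ℕ → ℕ
runℕ e m = iter δℕ m (initialℕ e)

runᶜ : Computable 2
runᶜ = byPrimRec (λ { (m ∷ e ∷ []) → runℕ e m })
         (compile (CALL x₀ (CONS x₀ (lit 0)) (lit 0))) (compile (app₁ δᶜ x₁))
         (λ { (e ∷ []) → refl }) (λ { m (e ∷ []) → refl })

halted : ℕ → ℕ
halted r = encState (ret r [])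

HaltsWith : ℕ → ℕ → Set
HaltsWith e r = ∃ λ m → runℕ e m ≡ halted r

self-application-halts : ∀ (c : Code 1) {r} → Eval c (encCode (erase c) ∷ []) r → HaltsWith (encCode (erase c)) r
self-application-halts c E = ↠⇒iterδℕ (eval⇒↠ E [])

halted-stable : ∀ k r → iter δℕ k (halted r) ≡ halted r
halted-stable zero    r = refl
halted-stable (suc k) r = trans (cong δℕ (halted-stable k r)) (δℕ-encState (ret r []))

halted-later : ∀ {e m n r} → runℕ e m ≡ halted r → m ≤ n → runℕ e n ≡ halted r
halted-later {e} {m} {n} {r} halts m≤n = begin
  runℕ e n                         ≡⟨ cong (λ k → iter δℕ k (initialℕ e)) (sym (m∸n+n≡m m≤n)) ⟩
  iter δℕ (n ∸ m + m) (initialℕ e) ≡⟨ iter-+ δℕ (n ∸ m) m (initialℕ e) ⟩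
  iter δℕ (n ∸ m) (runℕ e m)       ≡⟨ cong (iter δℕ (n ∸ m)) halts ⟩
  iter δℕ (n ∸ m) (halted r)       ≡⟨ halted-stable (n ∸ m) r ⟩
  halted r                         ∎
  where open ≡-Reasoning

halting-output-unique : ∀ {e r r′} → HaltsWith e r → HaltsWith e r′ → r ≡ r′
halting-output-unique {r = r} {r′ = r′} (m , halts) (m′ , halts′) = output-injective (common (≤-total m m′))
  where
  common : m ≤ m′ ⊎ m′ ≤ m → halted r ≡ halted r′
  common (inj₁ m≤m′) = trans (sym (halted-later halts m≤m′)) halts′
  common (inj₂ m′≤m) = trans (sym halts) (halted-later halts′ m′≤m)
  output-injective : halted r ≡ halted r′ → r ≡ r′
  output-injective eq = proj₁ (pair-injective (proj₂ (pair-injective eq)))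

equalᶜ : Computable 2
equalᶜ = compile (IFZ (app₂ addᶜ (app₂ monusᶜ x₀ x₁) (app₂ monusᶜ x₁ x₀)) (lit 1) (lit 0))

equalℕ : ℕ → ℕ → ℕ
equalℕ a b = fun equalᶜ (a ∷ b ∷ [])

equalℕ-≡ : ∀ {a b} → a ≡ b → equalℕ a b ≡ 1
equalℕ-≡ {a} refl rewrite n∸n≡0 a = refl

equalℕ-≢ : ∀ {a b} → a ≢ b → equalℕ a b ≡ 0
equalℕ-≢ {a} {b} a≢b with (a ∸ b) + (b ∸ a) in eq
... | suc _ = refl
... | zero  = contradiction (≤-antisym (m∸n≡0⇒m≤n (m+n≡0⇒m≡0 (a ∸ b) eq))
                                       (m∸n≡0⇒m≤n (m+n≡0⇒n≡0 (a ∸ b) eq))) a≢b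

-- 1 iff program e, run on its own code, has stopped with output 0 within m steps
stoppedᶜ : Computable 2
stoppedᶜ = compile (app₂ equalᶜ (app₂ runᶜ x₁ x₀) (RET (lit 0) (lit 0)))

stopped : ℕ → ℕ → ℕ
stopped e m = fun stoppedᶜ (e ∷ m ∷ [])

-- The two involutions

odd : ℕ → Bool
odd zero    = false
odd (suc n) = not (odd n)

parity : ℕ → ℕ
parity n = if odd n then 1 else 0

parityᶜ : Computable 1
parityᶜ = byPrimRec (λ { (n ∷ []) → parity n }) zeroᶜ (compile (app₂ monusᶜ (lit 1) x₁))
            (λ { [] → refl }) (λ { k [] → toggles k })
  where
  toggles : ∀ k → 1 ∸ parity k ≡ parity (suc k)
  toggles k with odd k
  ... | true  = refl
  ... | false = refl

ifZero-parity : ∀ n (a b : ℕ) → ifZero (parity n) a b ≡ (if odd n then b else a)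
ifZero-parity n a b with odd n
... | true  = refl
... | false = refl

half : ℕ → ℕ
half zero    = 0
half (suc n) = half n + parity n

halfᶜ : Computable 1
halfᶜ = byPrimRec (λ { (n ∷ []) → half n }) zeroᶜ (compile (app₂ addᶜ x₁ (app₁ parityᶜ x₀)))
          (λ { [] → refl }) (λ { k [] → refl })

flip : ℕ → ℕ
flip n = if odd n then pred n else suc n

flipᶜ : Computable 1
flipᶜ = withFun (compile (IFZ (app₁ parityᶜ x₀) (SUC x₀) (PRED x₀))) (λ { (n ∷ []) → flip n })
          (λ { (n ∷ []) → ifZero-parity n (suc n) (pred n) })

double : ℕ → ℕ
double zero    = 0
double (suc m) = suc (suc (double m))

data Halving : ℕ → Set where
  even : ∀ m → Halving (double m)
  odd+ : ∀ m → Halving (suc (double m))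

halving : ∀ n → Halving n
halving zero = even 0
halving (suc n) with halving n
... | even m = odd+ m
... | odd+ m = even (suc m)

odd-double : ∀ m → odd (double m) ≡ false
odd-double zero    = refl
odd-double (suc m) = cong (λ b → not (not b)) (odd-double m)

half-double : ∀ m → half (double m) ≡ m
half-suc-double : ∀ m → half (suc (double m)) ≡ m
half-double zero    = refl
half-double (suc m) rewrite half-suc-double m | odd-double m = +-comm m 1
half-suc-double m rewrite half-double m | odd-double m = +-identityʳ m

flip-double : ∀ m → flip (double m) ≡ suc (double m)
flip-double m rewrite odd-double m = refl

flip-suc-double : ∀ m → flip (suc (double m)) ≡ double m
flip-suc-double m rewrite odd-double m = refl

flip-involutive : ∀ n → flip (flip n) ≡ n
flip-involutive n with halving n
... | even m rewrite flip-double m = flip-suc-double m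
... | odd+ m rewrite flip-suc-double m = flip-double m

odd-flip : ∀ n → odd (flip n) ≡ not (odd n)
odd-flip n with halving n
... | even m rewrite flip-double m = refl
... | odd+ m rewrite flip-suc-double m = sym (not-involutive (odd (double m)))

half-flip : ∀ n → half (flip n) ≡ half n
half-flip n with halving n
... | even m rewrite flip-double m = trans (half-suc-double m) (sym (half-double m))
... | odd+ m rewrite flip-suc-double m = trans (half-double m) (sym (half-suc-double m))

node : ℕ → ℕ → ℕ → ℕ
node e s i = pair e (pair s i)

node-surjective : ∀ x → node (fst x) (fst (snd x)) (snd (snd x)) ≡ x
node-surjective x = trans (cong (pair (fst x)) (pair-fst-snd (snd x))) (pair-fst-snd x)

node-injective : ∀ {e s i e′ s′ i′} → node e s i ≡ node e′ s′ i′ → e ≡ e′ × s ≡ s′ × i ≡ i′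
node-injective eq with pair-injective eq
... | e≡e′ , rest with pair-injective rest
... | s≡s′ , i≡i′ = e≡e′ , s≡s′ , i≡i′

-- suc j and suc (flip j) are the indices 2k + 1 and 2k + 2 with k = half j
guardedSwapNode : ℕ → ℕ → ℕ → ℕ
guardedSwapNode e s zero    = node e (flip s) 0
guardedSwapNode e s (suc j) = ifZero (stopped e (half j)) (node e s (suc (flip j))) (node e s (suc j))

guardedSwap : ℕ → ℕ
guardedSwap x = guardedSwapNode (fst x) (fst (snd x)) (snd (snd x))

indexSwap : ℕ → ℕ
indexSwap x = node (fst x) (fst (snd x)) (flip (snd (snd x)))

guardedSwap-node : ∀ e s i → guardedSwap (node e s i) ≡ guardedSwapNode e s i
guardedSwap-node = unpair₃ guardedSwapNode

indexSwap-node : ∀ e s i → indexSwap (node e s i) ≡ node e s (flip i)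
indexSwap-node = unpair₃ (λ e s i → node e s (flip i))

rung-open : ∀ {e s j} → stopped e (half j) ≡ 0 → guardedSwapNode e s (suc j) ≡ node e s (suc (flip j))
rung-open {e} {s} {j} running = cong (λ b → ifZero b (node e s (suc (flip j))) (node e s (suc j))) running

rung-closed : ∀ {e s j n} → stopped e (half j) ≡ suc n → guardedSwapNode e s (suc j) ≡ node e s (suc j)
rung-closed {e} {s} {j} stops = cong (λ b → ifZero b (node e s (suc (flip j))) (node e s (suc j))) stops

guardedSwapNode-involutive : ∀ e s i → guardedSwap (guardedSwapNode e s i) ≡ node e s i
guardedSwapNode-involutive e s zero =
  trans (guardedSwap-node e (flip s) 0) (cong (λ s′ → node e s′ 0) (flip-involutive s))
guardedSwapNode-involutive e s (suc j) with stopped e (half j) in stop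
... | zero = begin
  guardedSwap (node e s (suc (flip j)))          ≡⟨ guardedSwap-node e s (suc (flip j)) ⟩
  guardedSwapNode e s (suc (flip j))             ≡⟨ rung-open (trans (cong (stopped e) (half-flip j)) stop) ⟩
  node e s (suc (flip (flip j)))                 ≡⟨ cong (λ i → node e s (suc i)) (flip-involutive j) ⟩
  node e s (suc j)                               ∎
  where open ≡-Reasoning
... | suc _ = trans (guardedSwap-node e s (suc j)) (rung-closed stop)

guardedSwap-involutive : ∀ x → guardedSwap (guardedSwap x) ≡ x
guardedSwap-involutive x =
  subst (λ y → guardedSwap (guardedSwap y) ≡ y) (node-surjective x) (involutive _ _ _)
  where
  involutive : ∀ e s i → guardedSwap (guardedSwap (node e s i)) ≡ node e s i
  involutive e s i = trans (cong guardedSwap (guardedSwap-node e s i)) (guardedSwapNode-involutive e s i)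

indexSwap-involutive : ∀ x → indexSwap (indexSwap x) ≡ x
indexSwap-involutive x = subst (λ y → indexSwap (indexSwap y) ≡ y) (node-surjective x) (involutive _ _ _)
  where
  involutive : ∀ e s i → indexSwap (indexSwap (node e s i)) ≡ node e s i
  involutive e s i = trans (cong indexSwap (indexSwap-node e s i))
                     (trans (indexSwap-node e s (flip i)) (cong (node e s) (flip-involutive i)))

NODE : ∀ {n} → Term n → Term n → Term n → Term n
NODE e s i = PAIR e (PAIR s i)

guardedSwapᶜ : Computable 1
guardedSwapᶜ = withFun
  (compile (IFZ i (NODE e (app₁ flipᶜ s) (lit 0))
                  (IFZ (app₂ stoppedᶜ e (app₁ halfᶜ (PRED i)))
                       (NODE e s (SUC (app₁ flipᶜ (PRED i))))
                       (NODE e s i))))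
  (λ { (x ∷ []) → guardedSwap x }) (λ { (x ∷ []) → agrees (snd (snd x)) })
  where
  e s i : Term 1
  e = FST x₀
  s = FST (SND x₀)
  i = SND (SND x₀)
  agrees : ∀ {e s} i →
    ifZero i (node e (flip s) 0) (ifZero (stopped e (half (pred i))) (node e s (suc (flip (pred i)))) (node e s i))
                       ≡ guardedSwapNode e s i
  agrees zero    = refl
  agrees (suc j) = refl

indexSwapᶜ : Computable 1
indexSwapᶜ = withFun (compile (NODE (FST x₀) (FST (SND x₀)) (app₁ flipᶜ (SND (SND x₀)))))
               (λ { (x ∷ []) → indexSwap x }) (λ { (x ∷ []) → refl })

module Involution (φᶜ : Computable 1) (involutive : ∀ x → fun φᶜ (fun φᶜ (x ∷ []) ∷ []) ≡ x) where

  φ : ℕ → ℕ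
  φ x = fun φᶜ (x ∷ [])

  perm : ℕ ↔ ℕ
  perm = mk↔ₛ′ φ φ involutive involutive

  iter-φ : ∀ k x → iter φ k x ≡ x ⊎ iter φ k x ≡ φ x
  iter-φ zero    x = inj₁ refl
  iter-φ (suc k) x with iter-φ k x
  ... | inj₁ at-x  = inj₂ (cong φ at-x)
  ... | inj₂ at-φx = inj₁ (trans (cong φ at-φx) (involutive x))

  power-φ : ∀ k x → (perm ^ᶻ k) x ≡ x ⊎ (perm ^ᶻ k) x ≡ φ x
  power-φ (+ k)     x = iter-φ k x
  power-φ -[1+ k ] x = iter-φ (suc k) x

  sameCycle : Term 2
  sameCycle = IFZ (app₂ addᶜ (app₂ equalᶜ x₁ x₀) (app₂ equalᶜ x₁ (app₁ φᶜ x₀))) (lit 0) (lit 1)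

  perm-InPerm : InPerm perm
  perm-InPerm = (code φᶜ , λ x → correct φᶜ (x ∷ [])) , codeOf sameCycle , λ x y → related x y , unrelated x y
    where
    decide : ∀ x y → Eval (codeOf sameCycle) (x ∷ y ∷ []) (ifZero (equalℕ y x + equalℕ y (φ x)) 0 1)
    decide x y = codeOf-correct sameCycle (x ∷ y ∷ [])
    related : ∀ x y → CycleRel perm x y → Eval (codeOf sameCycle) (x ∷ y ∷ []) 1
    related x y (k , y≡) with power-φ k x
    ... | inj₁ at-x  =
      subst (Eval _ _) (cong (λ a → ifZero (a + equalℕ y (φ x)) 0 1) (equalℕ-≡ (trans y≡ at-x))) (decide x y)
    ... | inj₂ at-φx =
      subst (Eval _ _) (trans (cong (λ b → ifZero (equalℕ y x + b) 0 1) (equalℕ-≡ (trans y≡ at-φx)))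
                              (cong (λ a → ifZero a 0 1) (+-comm (equalℕ y x) 1)))
            (decide x y)
    unrelated : ∀ x y → ¬ CycleRel perm x y → Eval (codeOf sameCycle) (x ∷ y ∷ []) 0
    unrelated x y ¬rel =
      subst (Eval _ _) (cong₂ (λ a b → ifZero (a + b) 0 1) (equalℕ-≢ (λ y≡x → ¬rel (+ 0 , y≡x)))
                                                         (equalℕ-≢ (λ y≡φx → ¬rel (+ 1 , y≡φx))))
            (decide x y)

module f = Involution guardedSwapᶜ guardedSwap-involutive
module g = Involution indexSwapᶜ indexSwap-involutive

-- Cycles of the composite

fg : ℕ → ℕ
fg x = guardedSwap (indexSwap x)

fg-node : ∀ e s i → fg (node e s i) ≡ guardedSwapNode e s (flip i)
fg-node e s i = trans (cong guardedSwap (indexSwap-node e s i)) (guardedSwap-node e s (flip i))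

module Climb {e t : ℕ} (running : ∀ {m} → m < t → stopped e m ≡ 0) (stops : stopped e t ≡ 1) where
  open ≡-Reasoning

  climb : ∀ {m} → m < t → fg (node e 0 (double m)) ≡ node e 0 (double (suc m))
  climb {m} m<t = begin
    fg (node e 0 (double m))              ≡⟨ fg-node e 0 (double m) ⟩
    guardedSwapNode e 0 (flip (double m)) ≡⟨ cong (guardedSwapNode e 0) (flip-double m) ⟩
    guardedSwapNode e 0 (suc (double m))  ≡⟨ rung-open (trans (cong (stopped e) (half-double m)) (running m<t)) ⟩
    node e 0 (suc (flip (double m)))      ≡⟨ cong (λ i → node e 0 (suc i)) (flip-double m) ⟩
    node e 0 (double (suc m))             ∎

  turn : fg (node e 0 (double t)) ≡ node e 0 (suc (double t))
  turn = begin
    fg (node e 0 (double t))              ≡⟨ fg-node e 0 (double t) ⟩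
    guardedSwapNode e 0 (flip (double t)) ≡⟨ cong (guardedSwapNode e 0) (flip-double t) ⟩
    guardedSwapNode e 0 (suc (double t))  ≡⟨ rung-closed (trans (cong (stopped e) (half-double t)) stops) ⟩
    node e 0 (suc (double t))             ∎

  descend : ∀ {m} → m < t → fg (node e 0 (suc (double (suc m)))) ≡ node e 0 (suc (double m))
  descend {m} m<t = begin
    fg (node e 0 (suc (double (suc m))))              ≡⟨ fg-node e 0 (suc (double (suc m))) ⟩
    guardedSwapNode e 0 (flip (suc (double (suc m)))) ≡⟨ cong (guardedSwapNode e 0) (flip-suc-double (suc m)) ⟩
    guardedSwapNode e 0 (suc (suc (double m)))        ≡⟨ rung-open (trans (cong (stopped e) (half-suc-double m)) (running m<t)) ⟩
    node e 0 (suc (flip (suc (double m))))            ≡⟨ cong (λ i → node e 0 (suc i)) (flip-suc-double m) ⟩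
    node e 0 (suc (double m))                         ∎

  ascent : ∀ {m} → m ≤ t → iter fg m (node e 0 0) ≡ node e 0 (double m)
  ascent {zero}  _      = refl
  ascent {suc m} 1+m≤t = trans (cong fg (ascent (<⇒≤ 1+m≤t))) (climb 1+m≤t)

  descent : ∀ {m} → m ≤ t → iter fg m (node e 0 (suc (double m))) ≡ node e 0 1
  descent {zero}  _      = refl
  descent {suc m} 1+m≤t = begin
    iter fg (suc m) (node e 0 (suc (double (suc m)))) ≡⟨ iter-inner fg m _ ⟨
    iter fg m (fg (node e 0 (suc (double (suc m)))))  ≡⟨ cong (iter fg m) (descend 1+m≤t) ⟩
    iter fg m (node e 0 (suc (double m)))             ≡⟨ descent (<⇒≤ 1+m≤t) ⟩
    node e 0 1                                        ∎

  reaches : iter fg (suc (t + suc t)) (node e 0 0) ≡ node e 1 0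
  reaches = begin
    fg (iter fg (t + suc t) (node e 0 0))          ≡⟨ cong fg (iter-+ fg t (suc t) _) ⟩
    fg (iter fg t (fg (iter fg t (node e 0 0))))   ≡⟨ cong (λ x → fg (iter fg t (fg x))) (ascent ≤-refl) ⟩
    fg (iter fg t (fg (node e 0 (double t))))      ≡⟨ cong (λ x → fg (iter fg t x)) turn ⟩
    fg (iter fg t (node e 0 (suc (double t))))     ≡⟨ cong fg (descent ≤-refl) ⟩
    fg (node e 0 1)                                ≡⟨ fg-node e 0 1 ⟩
    node e 1 0                                     ∎

least-witness : ∀ {P : ℕ → Set} → (∀ n → Dec (P n)) →
                ∀ {m} → P m → ∃ λ t → P t × (∀ {j} → j < t → ¬ P j)
least-witness {P} P? {m} = <-rec (λ m → P m → ∃ λ t → P t × (∀ {j} → j < t → ¬ P j)) search m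
  where
  search : ∀ m → (∀ {n} → n < m → P n → ∃ λ t → P t × (∀ {j} → j < t → ¬ P j)) →
           P m → ∃ λ t → P t × (∀ {j} → j < t → ¬ P j)
  search m smaller Pm with anyUpTo? P? m
  ... | yes (n , n<m , Pn) = smaller n<m Pn
  ... | no none-below      = m , Pm , λ j<m Pj → none-below (_ , j<m , Pj)

fgPerm : ℕ ↔ ℕ
fgPerm = f.perm ↔-∘ g.perm

halts⇒related : ∀ {e} → HaltsWith e 0 → CycleRel fgPerm (node e 0 0) (node e 1 0)
halts⇒related {e} (m , halts) with least-witness (λ n → runℕ e n ≟ halted 0) {m} halts
... | t , stops , running =
  + suc (t + suc t) , sym (Climb.reaches (λ j<t → equalℕ-≢ (running j<t)) (equalℕ-≡ stops))

Tone : ℕ → Bool → ℕ → Set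
Tone e b x = ∃₂ λ s i → x ≡ node e s i × odd s xor odd i ≡ b

Toggles : ℕ → (ℕ → ℕ) → Set
Toggles e θ = ∀ {b x} → Tone e b x → Tone e (not b) (θ x)

xor-toggleˡ : ∀ {a a′} b → a′ ≡ not a → a′ xor b ≡ not (a xor b)
xor-toggleˡ {a} b refl = sym (not-distribˡ-xor a b)

xor-toggleʳ : ∀ a {b b′} → b′ ≡ not b → a xor b′ ≡ not (a xor b)
xor-toggleʳ a {b} refl = sym (not-distribʳ-xor a b)

indexSwap-toggles : ∀ e → Toggles e indexSwap
indexSwap-toggles e (s , i , refl , tone) =
  s , flip i , indexSwap-node e s i , trans (xor-toggleʳ (odd s) (odd-flip i)) (cong not tone)

guardedSwap-toggles : ∀ {e} → (∀ m → stopped e m ≡ 0) → Toggles e guardedSwap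
guardedSwap-toggles {e} never (s , zero , refl , tone) =
  flip s , 0 , guardedSwap-node e s 0 , trans (xor-toggleˡ false (odd-flip s)) (cong not tone)
guardedSwap-toggles {e} never (s , suc j , refl , tone) =
  s , suc (flip j) , trans (guardedSwap-node e s (suc j)) (rung-open (never (half j))) ,
  trans (xor-toggleʳ (odd s) (cong not (odd-flip j))) (cong not tone)

toggles-∘ : ∀ {e θ θ′} → Toggles e θ → Toggles e θ′ → ∀ {b x} → Tone e b x → Tone e b (θ (θ′ x))
toggles-∘ {e} θ-toggles θ′-toggles {b} tone = subst (λ c → Tone e c _) (not-involutive b) (θ-toggles (θ′-toggles tone))

iter-preserves-Tone : ∀ {e b θ} → (∀ {x} → Tone e b x → Tone e b (θ x)) → ∀ k {x} → Tone e b x → Tone e b (iter θ k x)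
iter-preserves-Tone preserves zero    tone = tone
iter-preserves-Tone preserves (suc k) tone = preserves (iter-preserves-Tone preserves k tone)

never-stops⇒unrelated : ∀ {e} → (∀ m → stopped e m ≡ 0) → ¬ CycleRel fgPerm (node e 0 0) (node e 1 0)
never-stops⇒unrelated {e} never (k , reached) = wrong-tone (subst (Tone e false) (sym reached) (power-tone k))
  where
  power-tone : ∀ k → Tone e false ((fgPerm ^ᶻ k) (node e 0 0))
  power-tone (+ k)     = iter-preserves-Tone (toggles-∘ (guardedSwap-toggles never) (indexSwap-toggles e)) k
                                             (0 , 0 , refl , refl)
  power-tone -[1+ k ] = iter-preserves-Tone (toggles-∘ (indexSwap-toggles e) (guardedSwap-toggles never)) (suc k)
                                             (0 , 0 , refl , refl)
  wrong-tone : ¬ Tone e false (node e 1 0)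
  wrong-tone (s , i , eq , tone) with node-injective eq
  ... | _ , refl , refl = contradiction tone λ ()

self-halting-undecidable : ∀ (c : Code 1) →
  ¬ (∀ e → (HaltsWith e 0 → Eval c (e ∷ []) 1) × (¬ HaltsWith e 0 → Eval c (e ∷ []) 0))
self-halting-undecidable c decides = never-halts (self-application-halts c (proj₂ (decides e) never-halts))
  where
  e : ℕ
  e = encCode (erase c)
  never-halts : ¬ HaltsWith e 0
  never-halts halts with halting-output-unique halts (self-application-halts c (proj₁ (decides e) halts))
  ... | ()

fg-cycles-undecidable : ¬ DecidableRel (CycleRel fgPerm)
fg-cycles-undecidable (D , decides) = self-halting-undecidable reduction λ e →
  (λ halts → runs (proj₁ (decides _ _) (halts⇒related halts))) ,
  (λ ¬halts → runs (proj₂ (decides _ _) (never-stops⇒unrelated λ m → equalℕ-≢ λ halts → ¬halts (m , halts))))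
  where
  source target : Term 1
  source = NODE x₀ (lit 0) (lit 0)
  target = NODE x₀ (lit 1) (lit 0)
  reduction : Code 1
  reduction = comp D (codeOf source ∷ codeOf target ∷ [])
  runs : ∀ {e r} → Eval D (node e 0 0 ∷ node e 1 0 ∷ []) r → Eval reduction (e ∷ []) r
  runs {e} = e-comp (codeOf-correct source (e ∷ []) ∷ codeOf-correct target (e ∷ []) ∷ [])

corollary4p14 : Σ (ℕ ↔ ℕ) λ f → Σ (ℕ ↔ ℕ) λ g →
    InPerm f × InPerm g × ¬ InPerm (f ↔-∘ g)
corollary4p14 = f.perm , g.perm , f.perm-InPerm , g.perm-InPerm , λ (_ , decidable) → fg-cycles-undecidable decidable
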